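{- Let $G = (V,E)$ be a bipartite graph with bipartition $V = V_1 \cup V_2$ (each $V_i$ an independent set). Then there exists $D_0 \subseteq V$ such that $\delta_{loc}(G) + 1 = |D_0 \cup Odd(D_0)|$ and ($D_0 \subseteq V_1$ or $D_0 \subseteq V_2$).
   Context: All graphs are finite, simple and undirected. For $D \subseteq V(G)$, $Odd(D) = \{v \in V(G) : |\mathcal{N}(v)\cap D| \equiv 1 \pmod 2\}$, where $\mathcal{N}(v)$ is the neighborhood of $v$. The local complementation of $G$ at a vertex $u$ is $G * u = G \,\Delta\, K_{\mathcal{N}(u)}$ (symmetric difference of edge sets with the complete graph on $\mathcal{N}(u)$). $G \equiv_{LC} G'$ means $G'$ is obtained from $G$ by a finite sequence of local complementations, and $\delta_{loc}(G) = \min\{\delta(G') : G' \equiv_{LC} G\}$, where $\delta$ denotes minimum degree. (It is known that $\delta_{loc}(G) = \min\{|D \cup Odd(D)| : \varnothing \neq D \subseteq V(G)\} - 1$.) -}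

module Defs where

open import Data.Nat using (ℕ; _≤_; _%_; _≡ᵇ_)
open import Data.Bool using (Bool; true; false; not; if_then_else_; _∧_)
open import Data.Fin using (Fin; _≟_)
open import Data.Fin.Subset using (Subset; _∈_; _∩_; _∪_; ∣_∣; ⊤; Empty)
open import Data.Vec using (tabulate)
open import Data.Product using (Σ; ∃; _×_)
open import Relation.Nullary.Decidable using (⌊_⌋)
open import Relation.Binary.PropositionalEquality using (_≡_)

Adj : ℕ → Set
Adj n = Fin n → Fin n → Bool

record IsSimple {n : ℕ} (G : Adj n) : Set where
  field
    symm    : ∀ x y → G x y ≡ G y x
    irrefl  : ∀ x → G x x ≡ false

N : ∀ {n} → Adj n → Fin n → Subset n
N G v = tabulate (G v)

deg : ∀ {n} → Adj n → Fin n → ℕ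
deg G v = ∣ N G v ∣

IsMinDeg : ∀ {n} → Adj n → ℕ → Set
IsMinDeg G d = (∃ λ v → deg G v ≡ d) × (∀ v → d ≤ deg G v)

-- Local complementation G * u = G Δ K_{N(u)}
lc : ∀ {n} → Adj n → Fin n → Adj n
lc G u x y =
  if not ⌊ x ≟ y ⌋ ∧ G u x ∧ G u y then not (G x y) else G x y

data _≡LC_ {n : ℕ} (G : Adj n) : Adj n → Set where
  done : ∀ {H} → (∀ x y → G x y ≡ H x y) → G ≡LC H
  step : ∀ {H} u → lc G u ≡LC H → G ≡LC H

IsDeltaLoc : ∀ {n} → Adj n → ℕ → Set
IsDeltaLoc G k =
  (Σ (Adj _) λ H → G ≡LC H × IsMinDeg H k)
  × (∀ H d → G ≡LC H → IsMinDeg H d → k ≤ d)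

Odd : ∀ {n} → Adj n → Subset n → Subset n
Odd G D = tabulate (λ v → (∣ N G v ∩ D ∣ % 2) ≡ᵇ 1)

record IsBipartition {n : ℕ} (G : Adj n) (V₁ V₂ : Subset n) : Set where
  field
    cover     : V₁ ∪ V₂ ≡ ⊤
    disjoint  : Empty (V₁ ∩ V₂)
    indep₁    : ∀ x y → x ∈ V₁ → y ∈ V₁ → G x y ≡ false
    indep₂    : ∀ x y → x ∈ V₂ → y ∈ V₂ → G x y ≡ false

-- Local complementation at u sends D to D Δ {u} when u ∈ Odd(D) and leaves it alone
-- otherwise, and this preserves D ∪ Odd(D).  Pulling {v}, for v of minimum degree in an
-- LC-equivalent graph, back to G gives a nonempty D with |D ∪ Odd(D)| ≤ δ_loc + 1.
-- Conversely |D ∪ Odd(D)| > δ_loc for every nonempty D: for u ∈ D, either N(u) ⊆ D ∪ Odd(D),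
-- so deg u < |D ∪ Odd(D)|, or there is w ∈ N(u) outside D ∪ Odd(D); complementing at w
-- (unless already u ∈ Odd(D)) and then at u removes u from D without changing D ∪ Odd(D).
-- In a bipartite graph Odd(D ∩ Vᵢ) lies in the other side, where it agrees with Odd(D);
-- so (D ∩ Vᵢ) ∪ Odd(D ∩ Vᵢ) ⊆ D ∪ Odd(D), and some D ∩ Vᵢ is nonempty.
module Submission where

open import Defs
open import Algebra.Bundles using (CommutativeRing)
open import Data.Bool using (Bool; true; false; not; _∧_; _∨_; _xor_; if_then_else_)
open import Data.Bool.Properties
  using (xor-∧-commutativeRing; ∧-comm; ∧-conicalʳ; ∧-zeroʳ; ∧-identityʳ; ∧-distribˡ-xor; ∧-distribʳ-xor;
         xor-comm; xor-assoc; xor-same; xor-identityʳ)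
open import Algebra.Properties.Semiring.Sum (CommutativeRing.semiring xor-∧-commutativeRing)
  using (sum; sum-syntax; ∑-distrib-+; *-distribˡ-sum; sum-cong-≗; sum-remove; sum-replicate-zero)
open import Data.Empty using (⊥-elim)
open import Data.Fin using (Fin; zero; suc; _≟_; punchIn)
open import Data.Fin.Properties using (any?; punchInᵢ≢i)
open import Data.Fin.Subset using (Subset; _∈_; _∉_; _⊆_; _∩_; _∪_; _-_; ⁅_⁆; ∣_∣; Nonempty)
open import Data.Fin.Subset.Properties
  using (_∈?_; nonempty?; x∈p∪q⁻; x∈p∩q⁻; x∈p∩q⁺; p⊆p∪q; q⊆p∪q; p∩q⊆q; ∈⊤; x∈⁅x⁆;
         x∈p∧x≢y⇒x∈p-y; x∈p⇒∣p-x∣<∣p∣; p⊆q⇒∣p∣≤∣q∣; ∣p∣≤∣x∷p∣; ∪-identityˡ; p─⊥≡p)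
open import Data.List using (allFin)
open import Data.List.Extrema.Nat using (argmin; f[argmin]≤f[xs])
open import Data.List.Membership.Propositional.Properties using (∈-allFin)
import Data.List.Relation.Unary.All as All
open import Data.Nat using (ℕ; zero; suc; _≤_; _<_; _%_; _≡ᵇ_; s≤s)
open import Data.Nat.Induction using (<-wellFounded)
open import Data.Nat.Properties using (≤-trans; ≤-<-trans; ≤-antisym; ≤-reflexive)
open import Data.Product using (Σ; ∃; _×_; _,_; proj₁; proj₂)
open import Data.Sum using (_⊎_; inj₁; inj₂; [_,_]′)
open import Data.Vec using ([]; _∷_; lookup; tabulate)
open import Data.Vec.Properties
  using (lookup∘tabulate; lookup-zipWith; lookup-replicate; []=⇒lookup; lookup⇒[]=; tabulate∘lookup; tabulate-cong)
open import Function using (_∘_; id)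
open import Induction.WellFounded using (Acc; acc)
open import Relation.Nullary using (yes; no; ¬?)
open import Relation.Nullary.Decidable using (⌊_⌋; isYes≗does; ⌊⌋-map′; dec-true; dec-false; _×-dec_)
open import Relation.Binary.PropositionalEquality
open ≡-Reasoning

lookup≗⇒≡ : ∀ {n} {p q : Subset n} → (∀ x → lookup p x ≡ lookup q x) → p ≡ q
lookup≗⇒≡ {p = p} {q} eq = trans (sym (tabulate∘lookup p)) (trans (tabulate-cong eq) (tabulate∘lookup q))

lookup-∉ : ∀ {n} {x : Fin n} {p : Subset n} → x ∉ p → lookup p x ≡ false
lookup-∉ {x = x} {p} x∉p with lookup p x in eq
... | true = ⊥-elim (x∉p (lookup⇒[]= x p eq))
... | false = refl

⌊≟⌋-refl : ∀ {n} (x : Fin n) → ⌊ x ≟ x ⌋ ≡ true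
⌊≟⌋-refl x = trans (isYes≗does (x ≟ x)) (dec-true (x ≟ x) refl)

⌊≟⌋-≢ : ∀ {n} {x y : Fin n} → x ≢ y → ⌊ x ≟ y ⌋ ≡ false
⌊≟⌋-≢ {x = x} {y} x≢y = trans (isYes≗does (x ≟ y)) (dec-false (x ≟ y) x≢y)

⌊≟⌋-sym : ∀ {n} (x y : Fin n) → ⌊ x ≟ y ⌋ ≡ ⌊ y ≟ x ⌋
⌊≟⌋-sym x y with x ≟ y
... | yes refl = sym (⌊≟⌋-refl x)
... | no x≢y = sym (⌊≟⌋-≢ (x≢y ∘ sym))

lookup-⁅⁆ : ∀ {n} (u y : Fin n) → lookup ⁅ u ⁆ y ≡ ⌊ y ≟ u ⌋
lookup-⁅⁆ zero zero = refl
lookup-⁅⁆ zero (suc y) = lookup-replicate y false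
lookup-⁅⁆ (suc u) zero = refl
lookup-⁅⁆ (suc u) (suc y) = trans (lookup-⁅⁆ u y) (sym (⌊⌋-map′ _ _ (y ≟ u)))

∈-N : ∀ {n} (G : Adj n) {u y} → y ∈ N G u → G u y ≡ true
∈-N G {u} {y} y∈N = trans (sym (lookup∘tabulate (G u) y)) ([]=⇒lookup y∈N)

suc-%2≡ᵇ1 : ∀ m → (suc m % 2 ≡ᵇ 1) ≡ not (m % 2 ≡ᵇ 1)
suc-%2≡ᵇ1 zero = refl
suc-%2≡ᵇ1 (suc zero) = refl
suc-%2≡ᵇ1 (suc (suc m)) = suc-%2≡ᵇ1 m

∣p∣%2≡ᵇ1≡sum : ∀ {n} (p : Subset n) → (∣ p ∣ % 2 ≡ᵇ 1) ≡ sum (lookup p)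
∣p∣%2≡ᵇ1≡sum [] = refl
∣p∣%2≡ᵇ1≡sum (true ∷ p) = trans (suc-%2≡ᵇ1 ∣ p ∣) (cong not (∣p∣%2≡ᵇ1≡sum p))
∣p∣%2≡ᵇ1≡sum (false ∷ p) = ∣p∣%2≡ᵇ1≡sum p

lookup-Odd : ∀ {n} (G : Adj n) D x → lookup (Odd G D) x ≡ ∑[ y < n ] (G x y ∧ lookup D y)
lookup-Odd G D x = begin
  lookup (Odd G D) x          ≡⟨ lookup∘tabulate _ x ⟩
  ∣ N G x ∩ D ∣ % 2 ≡ᵇ 1     ≡⟨ ∣p∣%2≡ᵇ1≡sum (N G x ∩ D) ⟩
  sum (lookup (N G x ∩ D))    ≡⟨ sum-cong-≗ entry ⟩
  sum (λ y → G x y ∧ lookup D y) ∎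
  where
  entry : ∀ y → lookup (N G x ∩ D) y ≡ G x y ∧ lookup D y
  entry y = trans (lookup-zipWith _∧_ y (N G x) D) (cong (_∧ lookup D y) (lookup∘tabulate (G x) y))

∑-false : ∀ {n} {f : Fin n → Bool} → (∀ y → f y ≡ false) → sum f ≡ false
∑-false {n} f≡false = trans (sum-cong-≗ f≡false) (sum-replicate-zero n)

∑-single : ∀ {n} (f : Fin n → Bool) u → (∀ y → y ≢ u → f y ≡ false) → sum f ≡ f u
∑-single {suc n} f u vanish = begin
  sum f                                     ≡⟨ sum-remove {i = u} f ⟩
  f u xor sum (λ j → f (punchIn u j))       ≡⟨ cong (f u xor_) (∑-false (λ j → vanish _ (punchInᵢ≢i u j))) ⟩
  f u xor false                             ≡⟨ xor-identityʳ (f u) ⟩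
  f u                                       ∎

∑-true⇒∃ : ∀ {n} (f : Fin n → Bool) → sum f ≡ true → ∃ λ y → f y ≡ true
∑-true⇒∃ {suc n} f s with f zero in eq
... | true = zero , eq
... | false with ∑-true⇒∃ (f ∘ suc) s
...   | y , fy = suc y , fy

∑-punctured : ∀ {n} (f : Fin n → Bool) x → ∑[ y < n ] (not ⌊ x ≟ y ⌋ ∧ f y) ≡ sum f xor f x
∑-punctured {n} f x = cancel (begin
  sum f                           ≡⟨ sum-cong-≗ (λ y → split ⌊ x ≟ y ⌋ (f y)) ⟩
  sum (λ y → at y xor off y)      ≡⟨ ∑-distrib-+ at off ⟩
  sum at xor sum off              ≡⟨ cong (_xor sum off) sum-at ⟩
  f x xor sum off                 ∎)
  where
  at off : Fin n → Bool
  at y = ⌊ x ≟ y ⌋ ∧ f y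
  off y = not ⌊ x ≟ y ⌋ ∧ f y
  sum-at : sum at ≡ f x
  sum-at = trans (∑-single at x (λ y y≢x → cong (_∧ f y) (⌊≟⌋-≢ (y≢x ∘ sym))))
                 (cong (_∧ f x) (⌊≟⌋-refl x))
  split : ∀ b c → c ≡ (b ∧ c) xor (not b ∧ c)
  split true c = sym (xor-identityʳ c)
  split false c = refl
  cancel : ∀ {a b c} → a ≡ b xor c → c ≡ a xor b
  cancel {b = false} {false} refl = refl
  cancel {b = false} {true} refl = refl
  cancel {b = true} {false} refl = refl
  cancel {b = true} {true} refl = refl

lc-xor : ∀ {n} (G : Adj n) u x y → lc G u x y ≡ G x y xor (not ⌊ x ≟ y ⌋ ∧ G u x ∧ G u y)
lc-xor G u x y = trans (if-not _ (G x y)) (xor-comm _ (G x y))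
  where
  if-not : ∀ b c → (if b then not c else c) ≡ b xor c
  if-not true c = refl
  if-not false c = refl

module _ {n} {G : Adj n} (S : IsSimple G) where
  open IsSimple S

  lc-row : ∀ u y → lc G u u y ≡ G u y
  lc-row u y = begin
    lc G u u y                                      ≡⟨ lc-xor G u u y ⟩
    G u y xor (not ⌊ u ≟ y ⌋ ∧ G u u ∧ G u y)       ≡⟨ cong (λ b → G u y xor (not ⌊ u ≟ y ⌋ ∧ b ∧ G u y)) (irrefl u) ⟩
    G u y xor (not ⌊ u ≟ y ⌋ ∧ false)               ≡⟨ cong (G u y xor_) (∧-zeroʳ _) ⟩
    G u y xor false                                 ≡⟨ xor-identityʳ _ ⟩
    G u y                                           ∎

  lc-involutive : ∀ u x y → lc (lc G u) u x y ≡ G x y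
  lc-involutive u x y = begin
    lc (lc G u) u x y
      ≡⟨ lc-xor (lc G u) u x y ⟩
    lc G u x y xor (not ⌊ x ≟ y ⌋ ∧ lc G u u x ∧ lc G u u y)
      ≡⟨ cong₂ (λ a b → lc G u x y xor (not ⌊ x ≟ y ⌋ ∧ a ∧ b)) (lc-row u x) (lc-row u y) ⟩
    lc G u x y xor c
      ≡⟨ cong (_xor c) (lc-xor G u x y) ⟩
    (G x y xor c) xor c
      ≡⟨ xor-assoc (G x y) c c ⟩
    G x y xor (c xor c)
      ≡⟨ cong (G x y xor_) (xor-same c) ⟩
    G x y xor false
      ≡⟨ xor-identityʳ _ ⟩
    G x y ∎
    where c = not ⌊ x ≟ y ⌋ ∧ G u x ∧ G u y

  lc-simple : ∀ u → IsSimple (lc G u)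
  lc-simple u = record { symm = lc-symm ; irrefl = lc-irrefl }
    where
    lc-symm : ∀ x y → lc G u x y ≡ lc G u y x
    lc-symm x y = begin
      lc G u x y
        ≡⟨ lc-xor G u x y ⟩
      G x y xor (not ⌊ x ≟ y ⌋ ∧ G u x ∧ G u y)
        ≡⟨ cong₂ (λ a b → G x y xor (not a ∧ b)) (⌊≟⌋-sym x y) (∧-comm (G u x) (G u y)) ⟩
      G x y xor (not ⌊ y ≟ x ⌋ ∧ G u y ∧ G u x)
        ≡⟨ cong (_xor (not ⌊ y ≟ x ⌋ ∧ G u y ∧ G u x)) (symm x y) ⟩
      G y x xor (not ⌊ y ≟ x ⌋ ∧ G u y ∧ G u x)
        ≡⟨ lc-xor G u y x ⟨
      lc G u y x ∎
    lc-irrefl : ∀ x → lc G u x x ≡ false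
    lc-irrefl x = begin
      lc G u x x                                    ≡⟨ lc-xor G u x x ⟩
      G x x xor (not ⌊ x ≟ x ⌋ ∧ G u x ∧ G u x)     ≡⟨ cong (λ b → G x x xor (not b ∧ G u x ∧ G u x)) (⌊≟⌋-refl x) ⟩
      G x x xor false                               ≡⟨ xor-identityʳ _ ⟩
      G x x                                         ≡⟨ irrefl x ⟩
      false                                         ∎

≡LC-simple : ∀ {n} {G H : Adj n} → IsSimple G → G ≡LC H → IsSimple H
≡LC-simple S (done G≐H) = record
  { symm = λ x y → trans (sym (G≐H x y)) (trans (symm x y) (G≐H y x))
  ; irrefl = λ x → trans (sym (G≐H x x)) (irrefl x) }
  where open IsSimple S
≡LC-simple S (step u r) = ≡LC-simple (lc-simple S u) r

support : ∀ {n} → Adj n → Subset n → Subset n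
support G D = D ∪ Odd G D

lookup-support : ∀ {n} (G : Adj n) D x → lookup (support G D) x ≡ lookup D x ∨ lookup (Odd G D) x
lookup-support G D x = lookup-zipWith _∨_ x D (Odd G D)

support-cong : ∀ {n} {G H : Adj n} → (∀ x y → G x y ≡ H x y) → ∀ D → support G D ≡ support H D
support-cong G≐H D = cong (D ∪_) (tabulate-cong λ v → cong (λ p → ∣ p ∩ D ∣ % 2 ≡ᵇ 1) (tabulate-cong (G≐H v)))

lcImage : ∀ {n} → Adj n → Fin n → Subset n → Subset n
lcImage G u D = tabulate λ y → lookup D y xor (⌊ y ≟ u ⌋ ∧ lookup (Odd G D) u)

∑-toggle : ∀ {n} (G : Adj n) (D : Subset n) u b x →
  ∑[ y < n ] (G x y ∧ (lookup D y xor (⌊ y ≟ u ⌋ ∧ b))) ≡ lookup (Odd G D) x xor (G x u ∧ b)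
∑-toggle {n} G D u b x = begin
  ∑[ y < n ] (G x y ∧ (lookup D y xor (⌊ y ≟ u ⌋ ∧ b)))
    ≡⟨ sum-cong-≗ (λ y → ∧-distribˡ-xor (G x y) (lookup D y) _) ⟩
  ∑[ y < n ] ((G x y ∧ lookup D y) xor (G x y ∧ (⌊ y ≟ u ⌋ ∧ b)))
    ≡⟨ ∑-distrib-+ _ (λ y → G x y ∧ (⌊ y ≟ u ⌋ ∧ b)) ⟩
  ∑[ y < n ] (G x y ∧ lookup D y) xor ∑[ y < n ] (G x y ∧ (⌊ y ≟ u ⌋ ∧ b))
    ≡⟨ cong₂ _xor_ (sym (lookup-Odd G D x)) (∑-single _ u off-u) ⟩
  lookup (Odd G D) x xor (G x u ∧ (⌊ u ≟ u ⌋ ∧ b))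
    ≡⟨ cong (λ c → lookup (Odd G D) x xor (G x u ∧ (c ∧ b))) (⌊≟⌋-refl u) ⟩
  lookup (Odd G D) x xor (G x u ∧ b) ∎
  where
  off-u : ∀ y → y ≢ u → G x y ∧ (⌊ y ≟ u ⌋ ∧ b) ≡ false
  off-u y y≢u = trans (cong (λ c → G x y ∧ (c ∧ b)) (⌊≟⌋-≢ y≢u)) (∧-zeroʳ (G x y))

module _ {n} {G : Adj n} (S : IsSimple G) where
  open IsSimple S

  lookup-Odd-lc : ∀ u D x → lookup (Odd (lc G u) D) x ≡
    lookup (Odd G D) x xor (G u x ∧ (lookup (Odd G D) u xor (G u x ∧ lookup D x)))
  lookup-Odd-lc u D x = begin
    lookup (Odd (lc G u) D) x
      ≡⟨ lookup-Odd (lc G u) D x ⟩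
    ∑[ y < n ] (lc G u x y ∧ d y)
      ≡⟨ sum-cong-≗ entry ⟩
    ∑[ y < n ] ((G x y ∧ d y) xor (G u x ∧ (not ⌊ x ≟ y ⌋ ∧ (G u y ∧ d y))))
      ≡⟨ ∑-distrib-+ (λ y → G x y ∧ d y) (λ y → G u x ∧ (not ⌊ x ≟ y ⌋ ∧ (G u y ∧ d y))) ⟩
    ∑[ y < n ] (G x y ∧ d y) xor ∑[ y < n ] (G u x ∧ (not ⌊ x ≟ y ⌋ ∧ (G u y ∧ d y)))
      ≡⟨ cong₂ _xor_ (sym (lookup-Odd G D x)) (sym (*-distribˡ-sum (G u x) (λ y → not ⌊ x ≟ y ⌋ ∧ (G u y ∧ d y)))) ⟩
    lookup (Odd G D) x xor (G u x ∧ ∑[ y < n ] (not ⌊ x ≟ y ⌋ ∧ (G u y ∧ d y)))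
      ≡⟨ cong (λ s → lookup (Odd G D) x xor (G u x ∧ s)) (∑-punctured (λ y → G u y ∧ d y) x) ⟩
    lookup (Odd G D) x xor (G u x ∧ (∑[ y < n ] (G u y ∧ d y) xor (G u x ∧ d x)))
      ≡⟨ cong (λ s → lookup (Odd G D) x xor (G u x ∧ (s xor (G u x ∧ d x)))) (sym (lookup-Odd G D u)) ⟩
    lookup (Odd G D) x xor (G u x ∧ (lookup (Odd G D) u xor (G u x ∧ d x))) ∎
    where
    d = lookup D
    rearrange : ∀ a b c e → (not a ∧ b ∧ c) ∧ e ≡ b ∧ (not a ∧ (c ∧ e))
    rearrange false true c e = refl
    rearrange false false c e = refl
    rearrange true true c e = refl
    rearrange true false c e = refl
    entry : ∀ y → lc G u x y ∧ d y ≡ (G x y ∧ d y) xor (G u x ∧ (not ⌊ x ≟ y ⌋ ∧ (G u y ∧ d y)))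
    entry y = begin
      lc G u x y ∧ d y
        ≡⟨ cong (_∧ d y) (lc-xor G u x y) ⟩
      (G x y xor (not ⌊ x ≟ y ⌋ ∧ G u x ∧ G u y)) ∧ d y
        ≡⟨ ∧-distribʳ-xor (d y) (G x y) _ ⟩
      (G x y ∧ d y) xor ((not ⌊ x ≟ y ⌋ ∧ G u x ∧ G u y) ∧ d y)
        ≡⟨ cong ((G x y ∧ d y) xor_) (rearrange ⌊ x ≟ y ⌋ (G u x) (G u y) (d y)) ⟩
      (G x y ∧ d y) xor (G u x ∧ (not ⌊ x ≟ y ⌋ ∧ (G u y ∧ d y))) ∎

  lookup-Odd-lcImage : ∀ u D x →
    lookup (Odd (lc G u) (lcImage G u D)) x ≡ lookup (Odd G D) x xor (G u x ∧ lookup D x)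
  lookup-Odd-lcImage u D x = begin
    lookup (Odd (lc G u) (lcImage G u D)) x
      ≡⟨ lookup-Odd (lc G u) (lcImage G u D) x ⟩
    ∑[ y < n ] (lc G u x y ∧ lookup (lcImage G u D) y)
      ≡⟨ sum-cong-≗ (λ y → cong (lc G u x y ∧_) (lookup∘tabulate _ y)) ⟩
    ∑[ y < n ] (lc G u x y ∧ (lookup D y xor (⌊ y ≟ u ⌋ ∧ o)))
      ≡⟨ ∑-toggle (lc G u) D u o x ⟩
    lookup (Odd (lc G u) D) x xor (lc G u x u ∧ o)
      ≡⟨ cong₂ (λ a g → a xor (g ∧ o))
               (lookup-Odd-lc u D x) (trans (IsSimple.symm (lc-simple S u) x u) (lc-row S u x)) ⟩
    (O xor (G u x ∧ (o xor (G u x ∧ lookup D x)))) xor (G u x ∧ o)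
      ≡⟨ cancel O (G u x) o (lookup D x) ⟩
    O xor (G u x ∧ lookup D x) ∎
    where
    o = lookup (Odd G D) u
    O = lookup (Odd G D) x
    cancel : ∀ a g c e → (a xor (g ∧ (c xor (g ∧ e)))) xor (g ∧ c) ≡ a xor (g ∧ e)
    cancel a false c e = cong (_xor false) (xor-identityʳ a)
    cancel a true c e = begin
      (a xor (c xor e)) xor c  ≡⟨ xor-assoc a (c xor e) c ⟩
      a xor ((c xor e) xor c)  ≡⟨ cong (a xor_) (cong (_xor c) (xor-comm c e)) ⟩
      a xor ((e xor c) xor c)  ≡⟨ cong (a xor_) (xor-assoc e c c) ⟩
      a xor (e xor (c xor c))  ≡⟨ cong (λ z → a xor (e xor z)) (xor-same c) ⟩
      a xor (e xor false)      ≡⟨ cong (a xor_) (xor-identityʳ e) ⟩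
      a xor e                  ∎

  support-lc : ∀ u D → support (lc G u) (lcImage G u D) ≡ support G D
  support-lc u D = lookup≗⇒≡ λ x → begin
    lookup (support (lc G u) (lcImage G u D)) x
      ≡⟨ lookup-support (lc G u) (lcImage G u D) x ⟩
    lookup (lcImage G u D) x ∨ lookup (Odd (lc G u) (lcImage G u D)) x
      ≡⟨ cong₂ _∨_ (lookup∘tabulate _ x) (lookup-Odd-lcImage u D x) ⟩
    (lookup D x xor (⌊ x ≟ u ⌋ ∧ o)) ∨ (lookup (Odd G D) x xor (G u x ∧ lookup D x))
      ≡⟨ pointwise x ⟩
    lookup D x ∨ lookup (Odd G D) x
      ≡⟨ lookup-support G D x ⟨
    lookup (support G D) x ∎
    where
    o = lookup (Odd G D) u
    pointwise : ∀ x → (lookup D x xor (⌊ x ≟ u ⌋ ∧ o)) ∨ (lookup (Odd G D) x xor (G u x ∧ lookup D x))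
                      ≡ lookup D x ∨ lookup (Odd G D) x
    pointwise x with x ≟ u
    ... | yes refl rewrite irrefl x = at-u (lookup D x) o
      where
      at-u : ∀ a b → (a xor b) ∨ (b xor false) ≡ a ∨ b
      at-u true true = refl
      at-u true false = refl
      at-u false true = refl
      at-u false false = refl
    ... | no _ = off-u (lookup D x) (lookup (Odd G D) x) (G u x)
      where
      off-u : ∀ a b g → (a xor false) ∨ (b xor (g ∧ a)) ≡ a ∨ b
      off-u true b g = refl
      off-u false b g = trans (cong (b xor_) (∧-zeroʳ g)) (xor-identityʳ b)

lookup-remove : ∀ {n} (p : Subset n) u y → lookup (p - u) y ≡ not ⌊ y ≟ u ⌋ ∧ lookup p y
lookup-remove (s ∷ p) zero zero = refl
lookup-remove (s ∷ p) zero (suc y) = cong (λ q → lookup q y) (p─⊥≡p p)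
lookup-remove (s ∷ p) (suc u) zero = refl
lookup-remove (s ∷ p) (suc u) (suc y) =
  trans (lookup-remove p u y) (cong (λ b → not b ∧ lookup p y) (sym (⌊⌋-map′ _ _ (y ≟ u))))

lcImage-remove : ∀ {n} (G : Adj n) {u D} → u ∈ D → u ∈ Odd G D → lcImage G u D ≡ D - u
lcImage-remove G {u} {D} u∈D u∈Odd = lookup≗⇒≡ λ y → begin
  lookup (lcImage G u D) y                          ≡⟨ lookup∘tabulate _ y ⟩
  lookup D y xor (⌊ y ≟ u ⌋ ∧ lookup (Odd G D) u)   ≡⟨ cong (λ b → lookup D y xor (⌊ y ≟ u ⌋ ∧ b)) ([]=⇒lookup u∈Odd) ⟩
  lookup D y xor (⌊ y ≟ u ⌋ ∧ true)                 ≡⟨ toggle y ⟩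
  not ⌊ y ≟ u ⌋ ∧ lookup D y                        ≡⟨ lookup-remove D u y ⟨
  lookup (D - u) y                                  ∎
  where
  toggle : ∀ y → lookup D y xor (⌊ y ≟ u ⌋ ∧ true) ≡ not ⌊ y ≟ u ⌋ ∧ lookup D y
  toggle y with y ≟ u
  ... | yes refl rewrite []=⇒lookup u∈D = refl
  ... | no _ = xor-identityʳ (lookup D y)

lcImage-∉Odd : ∀ {n} (G : Adj n) {u D} → u ∉ Odd G D → lcImage G u D ≡ D
lcImage-∉Odd G {u} {D} u∉Odd = lookup≗⇒≡ λ y → begin
  lookup (lcImage G u D) y                          ≡⟨ lookup∘tabulate _ y ⟩
  lookup D y xor (⌊ y ≟ u ⌋ ∧ lookup (Odd G D) u)   ≡⟨ cong (λ b → lookup D y xor (⌊ y ≟ u ⌋ ∧ b)) (lookup-∉ u∉Odd) ⟩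
  lookup D y xor (⌊ y ≟ u ⌋ ∧ false)                ≡⟨ cong (lookup D y xor_) (∧-zeroʳ _) ⟩
  lookup D y xor false                              ≡⟨ xor-identityʳ _ ⟩
  lookup D y                                        ∎

module _ {n} {G : Adj n} (S : IsSimple G) where
  open IsSimple S

  ∉-N-self : ∀ u → u ∉ N G u
  ∉-N-self u u∈N with () ← trans (sym (irrefl u)) (∈-N G u∈N)

  deg<∣p∣ : ∀ {u p} → u ∈ p → N G u ⊆ p → deg G u < ∣ p ∣
  deg<∣p∣ {u} {p} u∈p N⊆p = ≤-<-trans (p⊆q⇒∣p∣≤∣q∣ N⊆p-u) (x∈p⇒∣p-x∣<∣p∣ u∈p)
    where
    N⊆p-u : N G u ⊆ p - u
    N⊆p-u {y} y∈N = x∈p∧x≢y⇒x∈p-y (N⊆p y∈N) λ { refl → ∉-N-self u y∈N }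

  support-remove : ∀ {u D} → u ∈ D → u ∈ Odd G D → support (lc G u) (D - u) ≡ support G D
  support-remove {u} {D} u∈D u∈Odd =
    trans (cong (support (lc G u)) (sym (lcImage-remove G u∈D u∈Odd))) (support-lc S u D)

  ∉Odd-⊆⁅⁆ : ∀ {u D} → (∀ y → y ≢ u → y ∉ D) → u ∉ Odd G D
  ∉Odd-⊆⁅⁆ {u} {D} only-u u∈Odd with () ← trans (sym ([]=⇒lookup u∈Odd)) (begin
    lookup (Odd G D) u
      ≡⟨ lookup-Odd G D u ⟩
    ∑[ y < n ] (G u y ∧ lookup D y)
      ≡⟨ ∑-single _ u (λ y y≢u → trans (cong (G u y ∧_) (lookup-∉ (only-u y y≢u))) (∧-zeroʳ _)) ⟩
    G u u ∧ lookup D u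
      ≡⟨ cong (_∧ lookup D u) (irrefl u) ⟩
    false ∎)

  remove-nonempty : ∀ {u D} → u ∈ D → u ∈ Odd G D → Nonempty (D - u)
  remove-nonempty {u} {D} u∈D u∈Odd with nonempty? (D - u)
  ... | yes ne = ne
  ... | no empty = ⊥-elim (∉Odd-⊆⁅⁆ (λ y y≢u y∈D → empty (y , x∈p∧x≢y⇒x∈p-y y∈D y≢u)) u∈Odd)

  support-lc-∉ : ∀ {w D} → w ∉ support G D → support (lc G w) D ≡ support G D
  support-lc-∉ {w} {D} w∉ = trans (cong (support (lc G w)) (sym (lcImage-∉Odd G w∉Odd))) (support-lc S w D)
    where w∉Odd = λ w∈Odd → w∉ (q⊆p∪q D (Odd G D) w∈Odd)

  ∈Odd-lc : ∀ {u w D} → u ∈ D → w ∈ N G u → w ∉ support G D → u ∉ Odd G D → u ∈ Odd (lc G w) D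
  ∈Odd-lc {u} {w} {D} u∈D w∈N w∉ u∉Odd = lookup⇒[]= u (Odd (lc G w) D) odd-u
    where
    odd-u : lookup (Odd (lc G w) D) u ≡ true
    odd-u = begin
      lookup (Odd (lc G w) D) u
        ≡⟨ lookup-Odd-lc S w D u ⟩
      lookup (Odd G D) u xor (G w u ∧ (lookup (Odd G D) w xor (G w u ∧ lookup D u)))
        ≡⟨ cong₂ (λ a g → a xor (g ∧ (lookup (Odd G D) w xor (g ∧ lookup D u))))
                 (lookup-∉ u∉Odd) (trans (symm w u) (∈-N G w∈N)) ⟩
      lookup (Odd G D) w xor lookup D u
        ≡⟨ cong₂ _xor_ (lookup-∉ (w∉ ∘ q⊆p∪q D (Odd G D))) ([]=⇒lookup u∈D) ⟩
      true ∎

support-pullback : ∀ {n} {G H : Adj n} → IsSimple G → G ≡LC H → ∀ E → ∃ λ D → support G D ≡ support H E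
support-pullback S (done G≐H) E = E , support-cong G≐H E
support-pullback {G = G} {H} S (step u r) E with support-pullback (lc-simple S u) r E
... | D , eq = lcImage (lc G u) u D , (begin
  support G (lcImage (lc G u) u D)                ≡⟨ support-cong (λ x y → sym (lc-involutive S u x y)) _ ⟩
  support (lc (lc G u) u) (lcImage (lc G u) u D)  ≡⟨ support-lc (lc-simple S u) u D ⟩
  support (lc G u) D                              ≡⟨ eq ⟩
  support H E                                     ∎)

LCDegreeBelow : ∀ {n} → Adj n → ℕ → Set
LCDegreeBelow {n} G s = Σ (Adj n) λ H → G ≡LC H × ∃ λ v → deg H v < s

lc-degreeBelow : ∀ {n} {G : Adj n} {s} u → LCDegreeBelow (lc G u) s → LCDegreeBelow G s
lc-degreeBelow u (H , r , below) = H , step u r , below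

support-degreeBelow : ∀ {n} {G : Adj n} → IsSimple G → ∀ D → Nonempty D → Acc _<_ ∣ D ∣ →
                      LCDegreeBelow G ∣ support G D ∣
∈Odd-support-degreeBelow : ∀ {n} {G : Adj n} → IsSimple G → ∀ {u D} → u ∈ D → u ∈ Odd G D → Acc _<_ ∣ D ∣ →
                           LCDegreeBelow G ∣ support G D ∣

∈Odd-support-degreeBelow {G = G} S {u} {D} u∈D u∈Odd (acc smaller) =
  lc-degreeBelow u (subst (LCDegreeBelow (lc G u) ∘ ∣_∣) (support-remove S u∈D u∈Odd)
    (support-degreeBelow (lc-simple S u) (D - u) (remove-nonempty S u∈D u∈Odd) (smaller (x∈p⇒∣p-x∣<∣p∣ u∈D))))

support-degreeBelow {G = G} S D (u , u∈D) acc-D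
  with any? (λ w → w ∈? N G u ×-dec ¬? (w ∈? support G D))
... | no N⊆support = G , done (λ _ _ → refl) , u , deg<∣p∣ S (p⊆p∪q (Odd G D) u∈D) N⊆
  where
  N⊆ : N G u ⊆ support G D
  N⊆ {w} w∈N with w ∈? support G D
  ... | yes w∈ = w∈
  ... | no w∉ = ⊥-elim (N⊆support (w , w∈N , w∉))
... | yes (w , w∈N , w∉) with u ∈? Odd G D
...   | yes u∈Odd = ∈Odd-support-degreeBelow S u∈D u∈Odd acc-D
...   | no u∉Odd = lc-degreeBelow w (subst (LCDegreeBelow (lc G w) ∘ ∣_∣) (support-lc-∉ S w∉)
          (∈Odd-support-degreeBelow (lc-simple S w) u∈D (∈Odd-lc S u∈D w∈N w∉ u∉Odd) acc-D))

minDegree-exists : ∀ {n} (H : Adj n) → Fin n → ∃ (IsMinDeg H)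
minDegree-exists {n} H v = deg H m , (m , refl) , λ w → All.lookup (f[argmin]≤f[xs] v (allFin n)) (∈-allFin w)
  where m = argmin (deg H) v (allFin n)

IsDeltaLoc⇒≤deg : ∀ {n} {G H : Adj n} {k} → IsDeltaLoc G k → G ≡LC H → ∀ v → k ≤ deg H v
IsDeltaLoc⇒≤deg {H = H} (_ , minimal) r v with minDegree-exists H v
... | d , isMin = ≤-trans (minimal H d r isMin) (proj₂ isMin v)

IsDeltaLoc⇒≤∣support∣ : ∀ {n} {G : Adj n} {k} → IsSimple G → IsDeltaLoc G k →
                         ∀ {D} → Nonempty D → suc k ≤ ∣ support G D ∣
IsDeltaLoc⇒≤∣support∣ S δ {D} ne with support-degreeBelow S D ne (<-wellFounded ∣ D ∣)
... | H , r , v , deg< = ≤-trans (s≤s (IsDeltaLoc⇒≤deg δ r v)) deg<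

Odd-⁅⁆ : ∀ {n} {H : Adj n} → IsSimple H → ∀ v → Odd H ⁅ v ⁆ ≡ N H v
Odd-⁅⁆ {H = H} S v = lookup≗⇒≡ λ x → begin
  lookup (Odd H ⁅ v ⁆) x               ≡⟨ lookup-Odd H ⁅ v ⁆ x ⟩
  ∑[ y < _ ] (H x y ∧ lookup ⁅ v ⁆ y)  ≡⟨ sum-cong-≗ (λ y → cong (H x y ∧_) (lookup-⁅⁆ v y)) ⟩
  ∑[ y < _ ] (H x y ∧ ⌊ y ≟ v ⌋)       ≡⟨ ∑-single _ v (λ y y≢v → trans (cong (H x y ∧_) (⌊≟⌋-≢ y≢v)) (∧-zeroʳ _)) ⟩
  H x v ∧ ⌊ v ≟ v ⌋                    ≡⟨ cong (H x v ∧_) (⌊≟⌋-refl v) ⟩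
  H x v ∧ true                         ≡⟨ ∧-identityʳ _ ⟩
  H x v                                ≡⟨ IsSimple.symm S x v ⟩
  H v x                                ≡⟨ lookup∘tabulate (H v) x ⟨
  lookup (N H v) x                     ∎

∣⁅x⁆∪p∣≤1+∣p∣ : ∀ {n} x (p : Subset n) → ∣ ⁅ x ⁆ ∪ p ∣ ≤ suc ∣ p ∣
∣⁅x⁆∪p∣≤1+∣p∣ zero (s ∷ p) = s≤s (≤-trans (≤-reflexive (cong ∣_∣ (∪-identityˡ p))) (∣p∣≤∣x∷p∣ s p))
∣⁅x⁆∪p∣≤1+∣p∣ (suc x) (true ∷ p) = s≤s (∣⁅x⁆∪p∣≤1+∣p∣ x p)
∣⁅x⁆∪p∣≤1+∣p∣ (suc x) (false ∷ p) = ∣⁅x⁆∪p∣≤1+∣p∣ x p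

∈support⇒nonempty : ∀ {n} (G : Adj n) D {x} → x ∈ support G D → Nonempty D
∈support⇒nonempty G D {x} x∈ with x∈p∪q⁻ D (Odd G D) x∈
... | inj₁ x∈D = x , x∈D
... | inj₂ x∈Odd with ∑-true⇒∃ _ (trans (sym (lookup-Odd G D x)) ([]=⇒lookup x∈Odd))
...   | y , edge∧y∈D = y , lookup⇒[]= y D (∧-conicalʳ (G x y) (lookup D y) edge∧y∈D)

IsDeltaLoc⇒attained : ∀ {n} {G : Adj n} {k} → IsSimple G → IsDeltaLoc G k →
                      ∃ λ D → Nonempty D × ∣ support G D ∣ ≤ suc k
IsDeltaLoc⇒attained {G = G} {k} S ((H , r , (v , deg≡k) , _) , _) with support-pullback S r ⁅ v ⁆
... | D , supp≡ = D , ∈support⇒nonempty G D v∈ , ≤-trans (≤-reflexive (cong ∣_∣ support≡)) ∣⁅v⁆∪N∣≤1+k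
  where
  support≡ : support G D ≡ ⁅ v ⁆ ∪ N H v
  support≡ = trans supp≡ (cong (⁅ v ⁆ ∪_) (Odd-⁅⁆ (≡LC-simple S r) v))
  ∣⁅v⁆∪N∣≤1+k : ∣ ⁅ v ⁆ ∪ N H v ∣ ≤ suc k
  ∣⁅v⁆∪N∣≤1+k = subst (λ d → ∣ ⁅ v ⁆ ∪ N H v ∣ ≤ suc d) deg≡k (∣⁅x⁆∪p∣≤1+∣p∣ v (N H v))
  v∈ : v ∈ support G D
  v∈ = subst (v ∈_) (sym supp≡) (p⊆p∪q (Odd H ⁅ v ⁆) (x∈⁅x⁆ v))

module _ {n} {G : Adj n} {A : Subset n}
         (indep-in : ∀ x y → x ∈ A → y ∈ A → G x y ≡ false)
         (indep-out : ∀ x y → x ∉ A → y ∉ A → G x y ≡ false) where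

  private
    lookup-∩-∈ : ∀ D {y} → y ∈ A → lookup (D ∩ A) y ≡ lookup D y
    lookup-∩-∈ D {y} y∈A =
      trans (lookup-zipWith _∧_ y D A) (trans (cong (lookup D y ∧_) ([]=⇒lookup y∈A)) (∧-identityʳ _))

    lookup-∩-∉ : ∀ D {y} → y ∉ A → lookup (D ∩ A) y ≡ false
    lookup-∩-∉ D {y} y∉A =
      trans (lookup-zipWith _∧_ y D A) (trans (cong (lookup D y ∧_) (lookup-∉ y∉A)) (∧-zeroʳ _))

  Odd-∩-∈ : ∀ D {x} → x ∈ A → lookup (Odd G (D ∩ A)) x ≡ false
  Odd-∩-∈ D {x} x∈A = trans (lookup-Odd G (D ∩ A) x) (∑-false term)
    where
    term : ∀ y → G x y ∧ lookup (D ∩ A) y ≡ false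
    term y with y ∈? A
    ... | yes y∈A = cong (_∧ lookup (D ∩ A) y) (indep-in x y x∈A y∈A)
    ... | no y∉A = trans (cong (G x y ∧_) (lookup-∩-∉ D y∉A)) (∧-zeroʳ _)

  Odd-∩-∉ : ∀ D {x} → x ∉ A → lookup (Odd G (D ∩ A)) x ≡ lookup (Odd G D) x
  Odd-∩-∉ D {x} x∉A = trans (lookup-Odd G (D ∩ A) x) (trans (sum-cong-≗ term) (sym (lookup-Odd G D x)))
    where
    term : ∀ y → G x y ∧ lookup (D ∩ A) y ≡ G x y ∧ lookup D y
    term y with y ∈? A
    ... | yes y∈A = cong (G x y ∧_) (lookup-∩-∈ D y∈A)
    ... | no y∉A = trans (cong (_∧ lookup (D ∩ A) y) no-edge) (sym (cong (_∧ lookup D y) no-edge))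
      where no-edge = indep-out x y x∉A y∉A

  support-∩⊆support : ∀ D → support G (D ∩ A) ⊆ support G D
  support-∩⊆support D {x} x∈ with x∈p∪q⁻ (D ∩ A) (Odd G (D ∩ A)) x∈
  ... | inj₁ x∈D∩A = p⊆p∪q (Odd G D) (proj₁ (x∈p∩q⁻ D A x∈D∩A))
  ... | inj₂ x∈Odd with x ∈? A
  ...   | yes x∈A with () ← trans (sym ([]=⇒lookup x∈Odd)) (Odd-∩-∈ D x∈A)
  ...   | no x∉A = q⊆p∪q D (Odd G D) (lookup⇒[]= x (Odd G D) (trans (sym (Odd-∩-∉ D x∉A)) ([]=⇒lookup x∈Odd)))

module _ {n} {G : Adj n} {V₁ V₂ : Subset n} (B : IsBipartition G V₁ V₂) where
  open IsBipartition B

  ∈V₁⊎∈V₂ : ∀ x → x ∈ V₁ ⊎ x ∈ V₂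
  ∈V₁⊎∈V₂ x = x∈p∪q⁻ V₁ V₂ (subst (x ∈_) (sym cover) ∈⊤)

  indep-∉V₁ : ∀ x y → x ∉ V₁ → y ∉ V₁ → G x y ≡ false
  indep-∉V₁ x y x∉ y∉ = indep₂ x y (∉V₁⇒∈V₂ x∉) (∉V₁⇒∈V₂ y∉)
    where
    ∉V₁⇒∈V₂ : ∀ {z} → z ∉ V₁ → z ∈ V₂
    ∉V₁⇒∈V₂ {z} z∉ = [ ⊥-elim ∘ z∉ , id ]′ (∈V₁⊎∈V₂ z)

  indep-∉V₂ : ∀ x y → x ∉ V₂ → y ∉ V₂ → G x y ≡ false
  indep-∉V₂ x y x∉ y∉ = indep₁ x y (∉V₂⇒∈V₁ x∉) (∉V₂⇒∈V₁ y∉)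
    where
    ∉V₂⇒∈V₁ : ∀ {z} → z ∉ V₂ → z ∈ V₁
    ∉V₂⇒∈V₁ {z} z∉ = [ id , ⊥-elim ∘ z∉ ]′ (∈V₁⊎∈V₂ z)

restriction-attains : ∀ {n} {G : Adj n} {k A} → IsSimple G → IsDeltaLoc G k →
  (∀ x y → x ∈ A → y ∈ A → G x y ≡ false) → (∀ x y → x ∉ A → y ∉ A → G x y ≡ false) →
  ∀ {D} → Nonempty (D ∩ A) → ∣ support G D ∣ ≤ suc k → suc k ≡ ∣ support G (D ∩ A) ∣
restriction-attains S δ indep-in indep-out {D} ne bound = ≤-antisym
  (IsDeltaLoc⇒≤∣support∣ S δ ne)
  (≤-trans (p⊆q⇒∣p∣≤∣q∣ (support-∩⊆support indep-in indep-out D)) bound)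

lemma5 : ∀ {n} (G : Adj n) → IsSimple G → (V₁ V₂ : Subset n) → IsBipartition G V₁ V₂ →
         ∀ k → IsDeltaLoc G k →
         ∃ λ (D₀ : Subset n) → suc k ≡ ∣ D₀ ∪ Odd G D₀ ∣ × (D₀ ⊆ V₁ ⊎ D₀ ⊆ V₂)
lemma5 G S V₁ V₂ B k δ with IsDeltaLoc⇒attained S δ
... | D , (y , y∈D) , bound with ∈V₁⊎∈V₂ B y
...   | inj₁ y∈V₁ = D ∩ V₁
                  , restriction-attains S δ (IsBipartition.indep₁ B) (indep-∉V₁ B) (y , x∈p∩q⁺ (y∈D , y∈V₁)) bound
                  , inj₁ (p∩q⊆q D V₁)
...   | inj₂ y∈V₂ = D ∩ V₂
                  , restriction-attains S δ (IsBipartition.indep₂ B) (indep-∉V₂ B) (y , x∈p∩q⁺ (y∈D , y∈V₂)) bound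
                  , inj₂ (p∩q⊆q D V₂)
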